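{- Let $T$ be a complete binary tree with height $h$, then $\mathrm{thin}(T) = \lceil\frac{h+1}{3}\rceil$.
   Context: A graph $G$ is $k$-thin if there exist a strict total order $\prec$ on $V(G)$ and a partition of $V(G)$ into $k$ classes such that for all $u \prec v \prec w$ with $u,v$ in the same class and $(u,w)\in E(G)$, also $(v,w)\in E(G)$; the thinness $\mathrm{thin}(G)$ is the minimum such $k$. A complete binary tree is a rooted tree in which every non-leaf vertex has 2 children and all leaves are at the same distance from the root; the height is the maximum number of edges on a path from the root to a leaf. -}

module Defs where

open import Level using (0ℓ)
open import Data.Nat using (ℕ; suc; _+_; _*_; _∸_; _^_; _/_; _≤_)
open import Data.Fin using (Fin; toℕ)
open import Data.Product using (Σ; _×_; _,_)
open import Data.Sum using (_⊎_)
open import Relation.Binary.Core using (Rel)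
open import Relation.Binary.Structures using (IsStrictTotalOrder)
open import Relation.Binary.PropositionalEquality using (_≡_)

IsKThin : {n : ℕ} → (E : Fin n → Fin n → Set) → ℕ → Set₁
IsKThin {n} E k =
  Σ (Rel (Fin n) 0ℓ) λ _≺_ →
  Σ (Fin n → Fin k) λ c →
    IsStrictTotalOrder _≡_ _≺_ ×
    (∀ u v w → u ≺ v → v ≺ w → c u ≡ c v → E u w → E v w)

Thinness : {n : ℕ} → (E : Fin n → Fin n → Set) → ℕ → Set₁
Thinness E m = IsKThin E m × (∀ k → IsKThin E k → m ≤ k)

-- The complete binary tree of height h, in heap numbering:
-- vertices 0 … 2^(h+1) − 2, root 0, the children of i are 2i+1 and 2i+2.
cbtSize : ℕ → ℕ
cbtSize h = 2 ^ (suc h) ∸ 1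

ParentOf : ℕ → ℕ → Set
ParentOf i j = (j ≡ 2 * i + 1) ⊎ (j ≡ 2 * i + 2)

CBTEdge : (h : ℕ) → Fin (cbtSize h) → Fin (cbtSize h) → Set
CBTEdge h u v = ParentOf (toℕ u) (toℕ v) ⊎ ParentOf (toℕ v) (toℕ u)

⌈_/3⌉ : ℕ → ℕ
⌈ m /3⌉ = (m + 2) / 3

-- Nodes of the heap-numbered tree are identified with their paths from the root.
--
-- Upper bound: order the nodes by a traversal that, according to a mode inherited along the
-- path, lists every node before, between or after its two subtrees, and colour a node by the
-- number of its strict ancestors that are listed before their subtrees. Such ancestors are at
-- least three levels apart, so ⌈(h+1)/3⌉ colours suffice, and the modes are chosen so that a
-- vertex of the same colour lying strictly between two neighbours is adjacent to the later one.
--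
-- Lower bound: fix a consistent order and colouring. If at least 3k levels lie below r, the
-- subtree at r contains k+1 vertices needing pairwise distinct colours, any two of them being
-- separated by a vertex after all of them that is adjacent to the earlier one only. For the
-- induction step take such families in the subtrees at r·LLL, r·LRL and r·R. The one whose last
-- vertex t lies between the last vertices of the other two grows: the path joining those two
-- avoids the subtree of t's family and its parent, so it crosses t along an edge uw with
-- u ≺ t ≺ w, and u joins the family, separated from the others by w.

module Submission where

open import Defs
open import Level using (0ℓ)
open import Function using (_∘_; _on_)
open import Function.Definitions using (Injective)
open import Data.Nat using (ℕ; zero; suc; _+_; _*_; _^_; _≤_; _<_; z≤n; s≤s; _/_)
open import Data.Nat.DivMod using (m/n≡1+[m∸n]/n; m*n/n≡m; /-monoˡ-≤; m/n*n≤m)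
open import Data.Nat.Properties
open import Data.Nat.Binary as Bin using (ℕᵇ; 2[1+_]; 1+[2_]; fromℕ)
open import Data.Nat.Binary.Properties as Binₚ using ()
open import Data.List using (List; []; _∷_; _++_; _∷ʳ_; foldl; length; initLast; _∷ʳ′_)
open import Data.List.Properties using (∷ʳ-injectiveˡ; ∷ʳ-++; ∷-injective; ∷-injectiveʳ; ++-cancelˡ; ++-assoc; ++-identityʳ; foldl-∷ʳ; length-++)
open import Data.Fin using (Fin; zero; suc; toℕ; fromℕ<)
open import Data.Fin.Properties using (toℕ-injective; toℕ-fromℕ<; toℕ<n; injective⇒≤)
open import Data.Product using (Σ; ∃; ∃₂; _×_; _,_; proj₁)
open import Data.Sum using (_⊎_; inj₁; inj₂)
open import Data.Empty using (⊥; ⊥-elim)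
open import Relation.Nullary using (¬_)
open import Relation.Binary.Core using (Rel)
open import Relation.Binary.Construct.Closure.ReflexiveTransitive using (Star; ε; _◅_; _◅◅_)
import Relation.Binary.Construct.Closure.ReflexiveTransitive as Star
open import Relation.Binary.Structures using (IsStrictTotalOrder)
open import Relation.Binary.Structures.Biased using (isStrictTotalOrderᶜ)
open import Relation.Binary.Definitions using (Trichotomous; Tri; tri<; tri≈; tri>)
open import Relation.Binary.PropositionalEquality.Properties using (isEquivalence)
open import Relation.Binary.PropositionalEquality
  using (_≡_; _≢_; refl; sym; trans; cong; subst; subst₂; module ≡-Reasoning)
open import Relation.Binary.Morphism.Structures using (IsOrderMonomorphism)
import Relation.Binary.Morphism.OrderMonomorphism as OrderMonomorphism

Consistent : {V : Set} → (V → V → Set) → Rel V 0ℓ → {k : ℕ} → (V → Fin k) → Set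
Consistent E _≺_ c = ∀ u v w → u ≺ v → v ≺ w → c u ≡ c v → E u w → E v w

IsThin : {V : Set} → (V → V → Set) → ℕ → Set₁
IsThin {V} E k = Σ (Rel V 0ℓ) λ _≺_ → Σ (V → Fin k) λ c → IsStrictTotalOrder _≡_ _≺_ × Consistent E _≺_ c

isStrictTotalOrder-injective : {A B : Set} {_<_ : Rel B 0ℓ} (f : A → B) → Injective _≡_ _≡_ f →
                               IsStrictTotalOrder _≡_ _<_ → IsStrictTotalOrder _≡_ (_<_ on f)
isStrictTotalOrder-injective f f-inj = OrderMonomorphism.isStrictTotalOrder isOrderMonomorphism
  where
  isOrderMonomorphism : IsOrderMonomorphism _≡_ _≡_ _ _ f
  isOrderMonomorphism = record
    { isOrderHomomorphism = record { cong = cong f ; mono = λ p → p }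
    ; injective = f-inj
    ; cancel = λ p → p
    }

isThin-induced : {A B : Set} {E : A → A → Set} {F : B → B → Set} (f : A → B) → Injective _≡_ _≡_ f →
                 (∀ {u v} → E u v → F (f u) (f v)) → (∀ {u v} → F (f u) (f v) → E u v) →
                 ∀ {k} → IsThin F k → IsThin E k
isThin-induced f f-inj E⇒F F⇒E (_≺_ , c , ≺-sto , consistent) =
  (_≺_ on f) , c ∘ f , isStrictTotalOrder-injective f f-inj ≺-sto ,
  λ u v w u≺v v≺w cu≡cv uw → F⇒E (consistent (f u) (f v) (f w) u≺v v≺w cu≡cv (E⇒F uw))

infix 4 _⊑_ _⋖_

_⊑_ : {A : Set} → List A → List A → Set
a ⊑ b = ∃ λ x → b ≡ a ++ x

_⋖_ : {A : Set} → List A → List A → Set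
a ⋖ b = ∃ λ d → b ≡ a ∷ʳ d

Incomparable : {A : Set} → List A → List A → Set
Incomparable a b = ¬ a ⊑ b × ¬ b ⊑ a

module _ {A : Set} where

  ⊑-refl : (a : List A) → a ⊑ a
  ⊑-refl a = [] , sym (++-identityʳ a)

  ⊑-trans : {a b c : List A} → a ⊑ b → b ⊑ c → a ⊑ c
  ⊑-trans {a} (x , refl) (y , refl) = x ++ y , ++-assoc a x y

  ⊑-++ : (a x : List A) → a ⊑ a ++ x
  ⊑-++ a x = x , refl

  ⋖⇒⊑ : {a b : List A} → a ⋖ b → a ⊑ b
  ⋖⇒⊑ (d , b≡) = d ∷ [] , b≡

  ⊑-length : {a b : List A} → a ⊑ b → length a ≤ length b
  ⊑-length {a} (x , refl) = ≤-trans (m≤m+n (length a) (length x)) (≤-reflexive (sym (length-++ a)))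

  ⊑-cancelˡ : (r : List A) {x y : List A} → r ++ x ⊑ r ++ y → x ⊑ y
  ⊑-cancelˡ r {x} (z , e) = z , ++-cancelˡ r _ _ (trans e (++-assoc r x z))

  ⊑-comparable : (a b : List A) {c : List A} → a ⊑ c → b ⊑ c → a ⊑ b ⊎ b ⊑ a
  ⊑-comparable []      b       _              _              = inj₁ (b , refl)
  ⊑-comparable (d ∷ a) []      _              _              = inj₂ (d ∷ a , refl)
  ⊑-comparable (d ∷ a) (e ∷ b) (x , refl) (y , e∷b++y≡) with ∷-injective e∷b++y≡
  ... | refl , a++x≡b++y with ⊑-comparable a b (x , refl) (y , a++x≡b++y)
  ...   | inj₁ (z , b≡) = inj₁ (z , cong (d ∷_) b≡)
  ...   | inj₂ (z , a≡) = inj₂ (z , cong (d ∷_) a≡)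

  incomparable-no-common-extension : {a b c : List A} → Incomparable a b → a ⊑ c → b ⊑ c → ⊥
  incomparable-no-common-extension {a} {b} (a⋢b , b⋢a) a⊑c b⊑c with ⊑-comparable a b a⊑c b⊑c
  ... | inj₁ a⊑b = a⋢b a⊑b
  ... | inj₂ b⊑a = b⋢a b⊑a

  incomparable-++ : (r : List A) {x y : List A} → Incomparable x y → Incomparable (r ++ x) (r ++ y)
  incomparable-++ r (x⋢y , y⋢x) = x⋢y ∘ ⊑-cancelˡ r , y⋢x ∘ ⊑-cancelˡ r

module _ {A : Set} {_<_ : Rel A 0ℓ} (<-sto : IsStrictTotalOrder _≡_ _<_) where
  open IsStrictTotalOrder <-sto using (compare; asym)

  Between : A → A → A → Set
  Between x t y = (x < t × t < y) ⊎ (y < t × t < x)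

  crossing : ∀ {R : Rel A 0ℓ} {t s e} → (∀ {u v} → R u v → v ≢ t) → Star R s e → s < t → t < e →
             ∃₂ λ u w → R u w × u < t × t < w
  crossing avoids ε s<t t<s = ⊥-elim (asym s<t t<s)
  crossing {t = t} {s} avoids (_◅_ {j = v} sv walk) s<t t<e with compare v t
  ... | tri< v<t _ _ = crossing avoids walk v<t t<e
  ... | tri≈ _ v≡t _ = ⊥-elim (avoids sv v≡t)
  ... | tri> _ _ t<v = s , v , sv , s<t , t<v

  middle-of-three : ∀ {a b c} → a ≢ b → b ≢ c → a ≢ c → Between b a c ⊎ Between a b c ⊎ Between a c b
  middle-of-three {a} {b} {c} a≢b b≢c a≢c with compare a b | compare b c | compare a c
  ... | tri≈ _ a≡b _ | _ | _ = ⊥-elim (a≢b a≡b)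
  ... | _ | tri≈ _ b≡c _ | _ = ⊥-elim (b≢c b≡c)
  ... | _ | _ | tri≈ _ a≡c _ = ⊥-elim (a≢c a≡c)
  ... | tri< a<b _ _ | tri< b<c _ _ | _            = inj₂ (inj₁ (inj₁ (a<b , b<c)))
  ... | tri> _ _ b<a | tri> _ _ c<b | _            = inj₂ (inj₁ (inj₂ (c<b , b<a)))
  ... | tri< a<b _ _ | tri> _ _ c<b | tri< a<c _ _ = inj₂ (inj₂ (inj₁ (a<c , c<b)))
  ... | tri< a<b _ _ | tri> _ _ c<b | tri> _ _ c<a = inj₁ (inj₂ (c<a , a<b))
  ... | tri> _ _ b<a | tri< b<c _ _ | tri< a<c _ _ = inj₁ (inj₁ (b<a , a<c))
  ... | tri> _ _ b<a | tri< b<c _ _ | tri> _ _ c<a = inj₂ (inj₂ (inj₂ (b<c , c<a)))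

data Dir : Set where
  left right : Dir

Addr : Set
Addr = List Dir

TreeEdge : Addr → Addr → Set
TreeEdge a b = a ⋖ b ⊎ b ⋖ a

TreeEdge-sym : ∀ {a b} → TreeEdge a b → TreeEdge b a
TreeEdge-sym (inj₁ ab) = inj₂ ab
TreeEdge-sym (inj₂ ba) = inj₁ ba

edge-leaving-subtree : ∀ {p z a b} → p ⋖ z → z ⊑ a → TreeEdge a b → z ⊑ b ⊎ b ≡ p
edge-leaving-subtree {z = z} _ (x , refl) (inj₁ (e , refl)) = inj₁ (x ∷ʳ e , ++-assoc z x (e ∷ []))
edge-leaving-subtree {p} {z} {b = b} (d , refl) (x , a≡z++x) (inj₂ (e , a≡b∷ʳe)) with initLast x
... | [] = inj₂ (∷ʳ-injectiveˡ b p (begin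
  b ∷ʳ e         ≡⟨ a≡b∷ʳe ⟨
  _              ≡⟨ a≡z++x ⟩
  p ∷ʳ d ++ []   ≡⟨ ++-identityʳ (p ∷ʳ d) ⟩
  p ∷ʳ d         ∎))
  where open ≡-Reasoning
... | y ∷ʳ′ f = inj₁ (y , ∷ʳ-injectiveˡ b (z ++ y) (begin
  b ∷ʳ e         ≡⟨ a≡b∷ʳe ⟨
  _              ≡⟨ a≡z++x ⟩
  z ++ (y ∷ʳ f)  ≡⟨ ++-assoc z y (f ∷ []) ⟨
  (z ++ y) ∷ʳ f  ∎))
  where open ≡-Reasoning

Far : Addr → Addr → Addr → Set
Far p z a = ¬ z ⊑ a × a ≢ p

far⇒¬edge : ∀ {p z a b} → p ⋖ z → z ⊑ a → Far p z b → ¬ TreeEdge a b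
far⇒¬edge p⋖z z⊑a (z⋢b , b≢p) ab with edge-leaving-subtree p⋖z z⊑a ab
... | inj₁ z⊑b = z⋢b z⊑b
... | inj₂ b≡p = b≢p b≡p

far-from-branch : ∀ {p z c x a} → p ⋖ z → Incomparable c p → c ⊑ x → a ⊑ x → Far p z a
far-from-branch p⋖z c∥p c⊑x a⊑x =
  (λ z⊑a → incomparable-no-common-extension c∥p c⊑x (⊑-trans (⋖⇒⊑ p⋖z) (⊑-trans z⊑a a⊑x))) ,
  (λ { refl → incomparable-no-common-extension c∥p c⊑x a⊑x })

far-below : ∀ {p z hub a} → Incomparable hub z → ¬ hub ⊑ p → hub ⊑ a → Far p z a
far-below hub∥z hub⋢p hub⊑a =
  (λ z⊑a → incomparable-no-common-extension hub∥z hub⊑a z⊑a) ,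
  (λ { refl → hub⋢p hub⊑a })

-- 1+[2 x ] and 2[1+ x ] denote 2x+1 and 2x+2, the heap children of x.
heapChild : ℕᵇ → Dir → ℕᵇ
heapChild x left  = 1+[2 x ]
heapChild x right = 2[1+ x ]

toBin : Addr → ℕᵇ
toBin = foldl heapChild Bin.zero

fromBin : ℕᵇ → Addr
fromBin Bin.zero  = []
fromBin 1+[2 x ]  = fromBin x ∷ʳ left
fromBin 2[1+ x ]  = fromBin x ∷ʳ right

fromBin-heapChild : ∀ x d → fromBin (heapChild x d) ≡ fromBin x ∷ʳ d
fromBin-heapChild x left  = refl
fromBin-heapChild x right = refl

fromBin-foldl : ∀ x a → fromBin (foldl heapChild x a) ≡ fromBin x ++ a
fromBin-foldl x []      = sym (++-identityʳ (fromBin x))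
fromBin-foldl x (d ∷ a) = begin
  fromBin (foldl heapChild (heapChild x d) a) ≡⟨ fromBin-foldl (heapChild x d) a ⟩
  fromBin (heapChild x d) ++ a                ≡⟨ cong (_++ a) (fromBin-heapChild x d) ⟩
  fromBin x ∷ʳ d ++ a                         ≡⟨ ++-assoc (fromBin x) (d ∷ []) a ⟩
  fromBin x ++ d ∷ a                          ∎
  where open ≡-Reasoning

fromBin-toBin : ∀ a → fromBin (toBin a) ≡ a
fromBin-toBin = fromBin-foldl Bin.zero

toBin-∷ʳ : ∀ a d → toBin (a ∷ʳ d) ≡ heapChild (toBin a) d
toBin-∷ʳ a d = foldl-∷ʳ heapChild Bin.zero d a

toBin-fromBin : ∀ x → toBin (fromBin x) ≡ x
toBin-fromBin Bin.zero = refl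
toBin-fromBin 1+[2 x ] = trans (toBin-∷ʳ (fromBin x) left) (cong 1+[2_] (toBin-fromBin x))
toBin-fromBin 2[1+ x ] = trans (toBin-∷ʳ (fromBin x) right) (cong 2[1+_] (toBin-fromBin x))

index : Addr → ℕ
index = Bin.toℕ ∘ toBin

index-injective : Injective _≡_ _≡_ index
index-injective {a} {b} e = begin
  a                   ≡⟨ sym (fromBin-toBin a) ⟩
  fromBin (toBin a)   ≡⟨ cong fromBin (Binₚ.toℕ-injective {toBin a} {toBin b} e) ⟩
  fromBin (toBin b)   ≡⟨ fromBin-toBin b ⟩
  b                   ∎
  where open ≡-Reasoning

index-fromBin-fromℕ : ∀ n → index (fromBin (fromℕ n)) ≡ n
index-fromBin-fromℕ n = trans (cong Bin.toℕ (toBin-fromBin (fromℕ n))) (Binₚ.toℕ-fromℕ n)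

index-∷ʳ-left : ∀ a → index (a ∷ʳ left) ≡ 2 * index a + 1
index-∷ʳ-left a = trans (cong Bin.toℕ (toBin-∷ʳ a left)) (+-comm 1 (2 * index a))

index-∷ʳ-right : ∀ a → index (a ∷ʳ right) ≡ 2 * index a + 2
index-∷ʳ-right a = trans (cong Bin.toℕ (toBin-∷ʳ a right)) (trans (*-suc 2 (index a)) (+-comm 2 (2 * index a)))

ParentOf⇒⋖ : ∀ a b → ParentOf (index a) (index b) → a ⋖ b
ParentOf⇒⋖ a b (inj₁ e) = left , index-injective (trans e (sym (index-∷ʳ-left a)))
ParentOf⇒⋖ a b (inj₂ e) = right , index-injective (trans e (sym (index-∷ʳ-right a)))

⋖⇒ParentOf : ∀ a b → a ⋖ b → ParentOf (index a) (index b)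
⋖⇒ParentOf a _ (left , refl)  = inj₁ (index-∷ʳ-left a)
⋖⇒ParentOf a _ (right , refl) = inj₂ (index-∷ʳ-right a)

length-∷ʳ : ∀ (a : Addr) d → length (a ∷ʳ d) ≡ suc (length a)
length-∷ʳ a d = trans (length-++ a) (+-comm (length a) 1)

2^length≤1+toℕ : ∀ x → 2 ^ length (fromBin x) ≤ suc (Bin.toℕ x)
2^length≤1+toℕ Bin.zero = ≤-refl
2^length≤1+toℕ 1+[2 x ] = begin
  2 ^ length (fromBin x ∷ʳ left) ≡⟨ cong (2 ^_) (length-∷ʳ (fromBin x) left) ⟩
  2 * 2 ^ length (fromBin x)     ≤⟨ *-monoʳ-≤ 2 (2^length≤1+toℕ x) ⟩
  2 * suc (Bin.toℕ x)            ≡⟨ *-suc 2 (Bin.toℕ x) ⟩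
  suc (Bin.toℕ 1+[2 x ])         ∎
  where open ≤-Reasoning
2^length≤1+toℕ 2[1+ x ] = begin
  2 ^ length (fromBin x ∷ʳ right) ≡⟨ cong (2 ^_) (length-∷ʳ (fromBin x) right) ⟩
  2 * 2 ^ length (fromBin x)      ≤⟨ *-monoʳ-≤ 2 (2^length≤1+toℕ x) ⟩
  Bin.toℕ 2[1+ x ]                ≤⟨ n≤1+n _ ⟩
  suc (Bin.toℕ 2[1+ x ])          ∎
  where open ≤-Reasoning

1+toℕ<2^1+length : ∀ x → suc (Bin.toℕ x) < 2 ^ suc (length (fromBin x))
1+toℕ<2^1+length Bin.zero = ≤-refl
1+toℕ<2^1+length 1+[2 x ] = begin
  suc (suc (suc (2 * Bin.toℕ x)))       ≤⟨ n≤1+n _ ⟩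
  suc (suc (suc (suc (2 * Bin.toℕ x)))) ≡⟨ cong (2 +_) (*-suc 2 (Bin.toℕ x)) ⟨
  suc (suc (2 * suc (Bin.toℕ x)))       ≡⟨ *-suc 2 (suc (Bin.toℕ x)) ⟨
  2 * suc (suc (Bin.toℕ x))             ≤⟨ *-monoʳ-≤ 2 (1+toℕ<2^1+length x) ⟩
  2 * 2 ^ suc (length (fromBin x))      ≡⟨ cong (λ n → 2 ^ suc n) (length-∷ʳ (fromBin x) left) ⟨
  2 ^ suc (length (fromBin x ∷ʳ left))  ∎
  where open ≤-Reasoning
1+toℕ<2^1+length 2[1+ x ] = begin
  suc (suc (2 * suc (Bin.toℕ x)))       ≡⟨ *-suc 2 (suc (Bin.toℕ x)) ⟨
  2 * suc (suc (Bin.toℕ x))             ≤⟨ *-monoʳ-≤ 2 (1+toℕ<2^1+length x) ⟩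
  2 * 2 ^ suc (length (fromBin x))      ≡⟨ cong (λ n → 2 ^ suc n) (length-∷ʳ (fromBin x) right) ⟨
  2 ^ suc (length (fromBin x ∷ʳ right)) ∎
  where open ≤-Reasoning

length≤⇒index< : ∀ {h} a → length a ≤ h → index a < cbtSize h
length≤⇒index< {h} a a≤h = <⇒≤pred (begin-strict
  suc (index a)                        <⟨ 1+toℕ<2^1+length (toBin a) ⟩
  2 ^ suc (length (fromBin (toBin a))) ≡⟨ cong (λ b → 2 ^ suc (length b)) (fromBin-toBin a) ⟩
  2 ^ suc (length a)                   ≤⟨ ^-monoʳ-≤ 2 (s≤s a≤h) ⟩
  2 ^ suc h                            ∎)
  where open ≤-Reasoning

index<⇒length≤ : ∀ {h} a → index a < cbtSize h → length a ≤ h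
index<⇒length≤ {h} a a<N = ≮⇒≥ λ h<len → <-irrefl refl (begin-strict
  2 ^ suc h                       ≤⟨ ^-monoʳ-≤ 2 h<len ⟩
  2 ^ length a                    ≡⟨ cong (λ b → 2 ^ length b) (fromBin-toBin a) ⟨
  2 ^ length (fromBin (toBin a))  ≤⟨ 2^length≤1+toℕ (toBin a) ⟩
  suc (index a)                   <⟨ m≤pred[n]⇒suc[m]≤n {{m^n≢0 2 (suc h)}} a<N ⟩
  2 ^ suc h                       ∎)
  where open ≤-Reasoning

-- The depth bound is irrelevant, so nodes with equal addresses are equal.
record Node (h : ℕ) : Set where
  constructor node
  field
    addr     : Addr
    .shallow : length addr ≤ h
open Node

addr-injective : ∀ {h} → Injective _≡_ _≡_ (addr {h})
addr-injective {x = node a _} {node .a _} refl = refl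

NodeEdge : ∀ {h} → Node h → Node h → Set
NodeEdge u v = TreeEdge (addr u) (addr v)

module HeapNumbering (h : ℕ) where

  toNode : Fin (cbtSize h) → Node h
  toNode v = node a (index<⇒length≤ a (subst (_< cbtSize h) (sym (index-fromBin-fromℕ (toℕ v))) (toℕ<n v)))
    where a = fromBin (fromℕ (toℕ v))

  fromNode : Node h → Fin (cbtSize h)
  fromNode (node a a≤h) = fromℕ< (length≤⇒index< a a≤h)

  index-toNode : ∀ v → index (addr (toNode v)) ≡ toℕ v
  index-toNode v = index-fromBin-fromℕ (toℕ v)

  toℕ-fromNode : ∀ u → toℕ (fromNode u) ≡ index (addr u)
  toℕ-fromNode (node a _) = toℕ-fromℕ< _

  toNode-injective : Injective _≡_ _≡_ toNode
  toNode-injective {x = u} {v} e =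
    toℕ-injective (trans (sym (index-toNode u)) (trans (cong (index ∘ addr) e) (index-toNode v)))

  fromNode-injective : Injective _≡_ _≡_ fromNode
  fromNode-injective {x = u} {v} e =
    addr-injective (index-injective (trans (sym (toℕ-fromNode u)) (trans (cong toℕ e) (toℕ-fromNode v))))

  module _ {u v : Fin (cbtSize h)} {a b : Addr} (ua : toℕ u ≡ index a) (vb : toℕ v ≡ index b) where

    CBTEdge⇒TreeEdge : CBTEdge h u v → TreeEdge a b
    CBTEdge⇒TreeEdge (inj₁ uv) = inj₁ (ParentOf⇒⋖ a b (subst₂ ParentOf ua vb uv))
    CBTEdge⇒TreeEdge (inj₂ vu) = inj₂ (ParentOf⇒⋖ b a (subst₂ ParentOf vb ua vu))

    TreeEdge⇒CBTEdge : TreeEdge a b → CBTEdge h u v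
    TreeEdge⇒CBTEdge (inj₁ ab) = inj₁ (subst₂ ParentOf (sym ua) (sym vb) (⋖⇒ParentOf a b ab))
    TreeEdge⇒CBTEdge (inj₂ ba) = inj₂ (subst₂ ParentOf (sym vb) (sym ua) (⋖⇒ParentOf b a ba))

  isThin-fromNodeTree : ∀ {k} → IsThin (NodeEdge {h}) k → IsThin (CBTEdge h) k
  isThin-fromNodeTree = isThin-induced toNode toNode-injective
    (λ {u v} → CBTEdge⇒TreeEdge (sym (index-toNode u)) (sym (index-toNode v)))
    (λ {u v} → TreeEdge⇒CBTEdge (sym (index-toNode u)) (sym (index-toNode v)))

  isThin-toNodeTree : ∀ {k} → IsThin (CBTEdge h) k → IsThin (NodeEdge {h}) k
  isThin-toNodeTree = isThin-induced fromNode fromNode-injective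
    (λ {u v} → TreeEdge⇒CBTEdge (toℕ-fromNode u) (toℕ-fromNode v))
    (λ {u v} → CBTEdge⇒TreeEdge (toℕ-fromNode u) (toℕ-fromNode v))

-- In the traversal of the subtree at a node of a given mode the left subtree precedes the right
-- one, and the node comes first (preorder), between them (inorder, inorder′) or last (postorder).
data Mode : Set where
  preorder inorder inorder′ postorder : Mode

childMode : Mode → Dir → Mode
childMode preorder  _     = inorder
childMode inorder   left  = postorder
childMode inorder   right = inorder′
childMode inorder′  left  = preorder
childMode inorder′  right = inorder′
childMode postorder left  = postorder
childMode postorder right = preorder

data RootFirst : Mode → Dir → Set where
  preorder  : ∀ {d} → RootFirst preorder d
  inorder   : RootFirst inorder right
  inorder′  : RootFirst inorder′ right

data RootLast : Mode → Dir → Set where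
  inorder   : RootLast inorder left
  inorder′  : RootLast inorder′ left
  postorder : ∀ {d} → RootLast postorder d

rootFirst⊎rootLast : ∀ m d → RootFirst m d ⊎ RootLast m d
rootFirst⊎rootLast preorder  _     = inj₁ preorder
rootFirst⊎rootLast inorder   left  = inj₂ inorder
rootFirst⊎rootLast inorder   right = inj₁ inorder
rootFirst⊎rootLast inorder′  left  = inj₂ inorder′
rootFirst⊎rootLast inorder′  right = inj₁ inorder′
rootFirst⊎rootLast postorder _     = inj₂ postorder

rootFirst⇒¬rootLast : ∀ {m d} → RootFirst m d → ¬ RootLast m d
rootFirst⇒¬rootLast inorder  ()
rootFirst⇒¬rootLast inorder′ ()

rootFirst-right : ∀ {m d} → RootFirst m d → RootFirst m right
rootFirst-right preorder = preorder
rootFirst-right inorder  = inorder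
rootFirst-right inorder′ = inorder′

rootLast-left : ∀ {m d} → RootLast m d → RootLast m left
rootLast-left inorder   = inorder
rootLast-left inorder′  = inorder′
rootLast-left postorder = postorder

data Before : Mode → Addr → Addr → Set where
  root-first : ∀ {m d b} → RootFirst m d → Before m [] (d ∷ b)
  root-last  : ∀ {m d a} → RootLast m d → Before m (d ∷ a) []
  left-right : ∀ {m a b} → Before m (left ∷ a) (right ∷ b)
  descend    : ∀ {m d a b} → Before (childMode m d) a b → Before m (d ∷ a) (d ∷ b)

Before-irrefl : ∀ {m a} → ¬ Before m a a
Before-irrefl (descend p) = Before-irrefl p

Before-trans : ∀ {m a b c} → Before m a b → Before m b c → Before m a c
Before-trans (root-first p) (root-last q)  = ⊥-elim (rootFirst⇒¬rootLast p q)
Before-trans (root-first p) left-right     = root-first (rootFirst-right p)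
Before-trans (root-first p) (descend _)    = root-first p
Before-trans (root-last inorder) (root-first inorder)   = left-right
Before-trans (root-last inorder′) (root-first inorder′) = left-right
Before-trans left-right (root-last q)      = root-last (rootLast-left q)
Before-trans left-right (descend _)        = left-right
Before-trans (descend _) (root-last q)     = root-last q
Before-trans (descend _) left-right        = left-right
Before-trans (descend p) (descend q)       = descend (Before-trans p q)

Before-descend⁻ : ∀ {m d a b} → Before m (d ∷ a) (d ∷ b) → Before (childMode m d) a b
Before-descend⁻ (descend p) = p

descend-compare : ∀ {m d a b} → Tri (Before (childMode m d) a b) (a ≡ b) (Before (childMode m d) b a) →
                  Tri (Before m (d ∷ a) (d ∷ b)) (d ∷ a ≡ d ∷ b) (Before m (d ∷ b) (d ∷ a))
descend-compare (tri< p a≢b ¬q) = tri< (descend p) (a≢b ∘ ∷-injectiveʳ) (¬q ∘ Before-descend⁻)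
descend-compare (tri≈ ¬p refl ¬q) = tri≈ (¬p ∘ Before-descend⁻) refl (¬q ∘ Before-descend⁻)
descend-compare (tri> ¬p a≢b q) = tri> (¬p ∘ Before-descend⁻) (a≢b ∘ ∷-injectiveʳ) (descend q)

Before-compare : ∀ m → Trichotomous _≡_ (Before m)
Before-compare m [] [] = tri≈ Before-irrefl refl Before-irrefl
Before-compare m [] (d ∷ b) with rootFirst⊎rootLast m d
... | inj₁ p = tri< (root-first p) (λ ()) λ { (root-last q) → rootFirst⇒¬rootLast p q }
... | inj₂ q = tri> (λ { (root-first p) → rootFirst⇒¬rootLast p q }) (λ ()) (root-last q)
Before-compare m (d ∷ a) [] with rootFirst⊎rootLast m d
... | inj₁ p = tri> (λ { (root-last q) → rootFirst⇒¬rootLast p q }) (λ ()) (root-first p)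
... | inj₂ q = tri< (root-last q) (λ ()) λ { (root-first p) → rootFirst⇒¬rootLast p q }
Before-compare m (left ∷ a)  (right ∷ b) = tri< left-right (λ ()) (λ ())
Before-compare m (right ∷ a) (left ∷ b)  = tri> (λ ()) (λ ()) left-right
Before-compare m (left ∷ a)  (left ∷ b)  = descend-compare (Before-compare (childMode m left) a b)
Before-compare m (right ∷ a) (right ∷ b) = descend-compare (Before-compare (childMode m right) a b)

Before-isStrictTotalOrder : ∀ m → IsStrictTotalOrder _≡_ (Before m)
Before-isStrictTotalOrder m = isStrictTotalOrderᶜ record
  { isEquivalence = isEquivalence
  ; trans         = Before-trans
  ; compare       = Before-compare m
  }

bump : Mode → ℕ
bump preorder = 1
bump _        = 0

colour : Mode → Addr → ℕ
colour m []      = 0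
colour m (d ∷ a) = bump m + colour (childMode m d) a

-- At the root, a node precedes its child d only in the inorder modes with d = right; what lies
-- in between is the subtree of the child's left child, a preorder node, below which colours grow.
between-parent-child : ∀ {m} u d {v} → Before m u v → Before m v (u ∷ʳ d) → colour m v ≡ colour m u → u ∷ʳ d ⋖ v
between-parent-child (e ∷ u) d (root-last p) (root-first q) _ = ⊥-elim (rootFirst⇒¬rootLast q p)
between-parent-child (e ∷ u) d (descend p) (descend q) c with between-parent-child u d p q (+-cancelˡ-≡ (bump _) _ _ c)
... | f , refl = f , refl
between-parent-child [] d (root-first preorder) _ ()
between-parent-child [] right {right ∷ left ∷ []} (root-first inorder)  (descend (root-last inorder′)) _ = left , refl
between-parent-child [] right {right ∷ left ∷ []} (root-first inorder′) (descend (root-last inorder′)) _ = left , refl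
between-parent-child [] right {right ∷ left ∷ _ ∷ _} (root-first inorder)  (descend (root-last inorder′)) ()
between-parent-child [] right {right ∷ left ∷ _ ∷ _} (root-first inorder′) (descend (root-last inorder′)) ()

-- At the root, what follows the child and precedes its parent is either the child's own subtree
-- (empty or of larger colour) or, for a left child in postorder mode, the right subtree, whose
-- root is a preorder node.
between-child-parent : ∀ {m} w d {v} → Before m (w ∷ʳ d) v → Before m v w → colour m v ≡ colour m (w ∷ʳ d) → w ⋖ v
between-child-parent (e ∷ w) d (root-last p) (root-first q) _ = ⊥-elim (rootFirst⇒¬rootLast q p)
between-child-parent (e ∷ w) d (descend p) (descend q) c with between-child-parent w d p q (+-cancelˡ-≡ (bump _) _ _ c)
... | f , refl = f , refl
between-child-parent [] d {right ∷ []} left-right (root-last postorder) _ = right , refl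
between-child-parent [] d {right ∷ _ ∷ _} left-right (root-last postorder) ()
between-child-parent [] d (descend (root-first p)) (root-last inorder′) ()
between-child-parent [] d (descend (root-first ())) (root-last inorder)
between-child-parent [] left (descend (root-first ())) (root-last postorder)
between-child-parent [] right (descend (root-first p)) (root-last postorder) ()

-- A potential showing that preorder nodes are at least three levels apart on every path.
weight : Mode → ℕ
weight preorder  = 2
weight inorder   = 0
weight inorder′  = 1
weight postorder = 1

bump+weight≤ : ∀ m d → 3 * bump m + weight (childMode m d) ≤ suc (weight m)
bump+weight≤ preorder  _     = ≤-refl
bump+weight≤ inorder   left  = ≤-refl
bump+weight≤ inorder   right = ≤-refl
bump+weight≤ inorder′  left  = ≤-refl
bump+weight≤ inorder′  right = n≤1+n _
bump+weight≤ postorder left  = n≤1+n _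
bump+weight≤ postorder right = ≤-refl

colour-bound : ∀ m a → 3 * colour m a ≤ weight m + length a
colour-bound m []      = z≤n
colour-bound m (d ∷ a) = begin
  3 * (bump m + colour m′ a)            ≡⟨ *-distribˡ-+ 3 (bump m) (colour m′ a) ⟩
  3 * bump m + 3 * colour m′ a          ≤⟨ +-monoʳ-≤ (3 * bump m) (colour-bound m′ a) ⟩
  3 * bump m + (weight m′ + length a)   ≡⟨ +-assoc (3 * bump m) (weight m′) (length a) ⟨
  3 * bump m + weight m′ + length a     ≤⟨ +-monoˡ-≤ (length a) (bump+weight≤ m d) ⟩
  suc (weight m) + length a             ≡⟨ +-suc (weight m) (length a) ⟨
  weight m + suc (length a)             ∎
  where
  m′ = childMode m d
  open ≤-Reasoning

Before-consistent : ∀ {m u v w} → Before m u v → Before m v w → colour m u ≡ colour m v → TreeEdge u w → TreeEdge v w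
Before-consistent u<v v<w c (inj₁ (d , refl)) = inj₂ (between-parent-child _ d u<v v<w (sym c))
Before-consistent u<v v<w c (inj₂ (d , refl)) = inj₂ (between-child-parent _ d u<v v<w (sym c))

⌈1+h/3⌉≡1+h/3 : ∀ h → ⌈ suc h /3⌉ ≡ suc (h / 3)
⌈1+h/3⌉≡1+h/3 h = trans (m/n≡1+[m∸n]/n {suc h + 2} {3} (s≤s (m≤n+m 2 h)))
                        (cong (λ n → suc (n / 3)) (m+n∸n≡m h 2))

colour<⌈1+h/3⌉ : ∀ {h} a → length a ≤ h → colour inorder a < ⌈ suc h /3⌉
colour<⌈1+h/3⌉ {h} a a≤h = subst (colour inorder a <_) (sym (⌈1+h/3⌉≡1+h/3 h)) (s≤s (begin
  colour inorder a               ≡⟨ m*n/n≡m (colour inorder a) 3 ⟨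
  colour inorder a * 3 / 3       ≤⟨ /-monoˡ-≤ 3 (≤-trans (≤-reflexive (*-comm (colour inorder a) 3))
                                                  (≤-trans (colour-bound inorder a) a≤h)) ⟩
  h / 3                          ∎))
  where open ≤-Reasoning

isThin-nodeTree : ∀ h → IsThin (NodeEdge {h}) ⌈ suc h /3⌉
isThin-nodeTree h =
  (Before inorder on addr) , colourOf , isStrictTotalOrder-injective addr addr-injective (Before-isStrictTotalOrder inorder) ,
  λ u v w u<v v<w c → Before-consistent u<v v<w (trans (sym (toℕ-colourOf u)) (trans (cong toℕ c) (toℕ-colourOf v)))
  where
  colourOf : Node h → Fin ⌈ suc h /3⌉
  colourOf (node a a≤h) = fromℕ< (colour<⌈1+h/3⌉ a a≤h)
  toℕ-colourOf : ∀ u → toℕ (colourOf u) ≡ colour inorder (addr u)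
  toℕ-colourOf (node a _) = toℕ-fromℕ< _

module _ {h : ℕ} where

  Walk : (Addr → Set) → Rel (Node h) 0ℓ
  Walk Q = Star (λ u v → Q (addr u) × Q (addr v) × NodeEdge u v)

  walk-reverse : ∀ {Q u v} → Walk Q u v → Walk Q v u
  walk-reverse = Star.reverse λ (qu , qv , uv) → qv , qu , TreeEdge-sym uv

  descent : ∀ {Q : Addr → Set} a x {b} .{p : length a ≤ h} .{q : length b ≤ h} → b ≡ a ++ x →
            (∀ c → a ⊑ c → c ⊑ b → Q c) → Walk Q (node a p) (node b q)
  descent a [] b≡a++[] _ with trans b≡a++[] (++-identityʳ a)
  ... | refl = ε
  descent a (d ∷ x) {q = q} b≡ Q-between =
    (Q-between a (⊑-refl a) (d ∷ x , b≡) , Q-between (a ∷ʳ d) (⊑-++ a (d ∷ [])) a∷ʳd⊑b , inj₁ (d , refl)) ◅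
    descent (a ∷ʳ d) x {p = ≤-trans (⊑-length a∷ʳd⊑b) q} b≡′
      (λ c a∷ʳd⊑c → Q-between c (⊑-trans (⊑-++ a (d ∷ [])) a∷ʳd⊑c))
    where
    b≡′ = trans b≡ (sym (∷ʳ-++ a d x))
    a∷ʳd⊑b = x , b≡′

room-below : ∀ {h k} (r x : Addr) → length r + 3 * suc k ≤ h → length x ≤ 3 → length (r ++ x) + 3 * k ≤ h
room-below {h} {k} r x room x≤3 = begin
  length (r ++ x) + 3 * k     ≡⟨ cong (_+ 3 * k) (length-++ r) ⟩
  length r + length x + 3 * k ≤⟨ +-monoˡ-≤ (3 * k) (+-monoʳ-≤ (length r) x≤3) ⟩
  length r + 3 + 3 * k        ≡⟨ +-assoc (length r) 3 (3 * k) ⟩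
  length r + (3 + 3 * k)      ≡⟨ cong (length r +_) (*-suc 3 k) ⟨
  length r + 3 * suc k        ≤⟨ room ⟩
  h                           ∎
  where open ≤-Reasoning

module LowerBound {h : ℕ} {_≺_ : Rel (Node h) 0ℓ} (≺-sto : IsStrictTotalOrder _≡_ _≺_) where
  open IsStrictTotalOrder ≺-sto using (compare; irrefl; asym) renaming (trans to ≺-trans)

  -- k+1 vertices of the subtree at r, each pair separated by a vertex after member top that is
  -- adjacent to the earlier vertex only; a consistent colouring must tell them apart.
  record Separated (k : ℕ) (r : Addr) : Set where
    field
      member    : Fin (suc k) → Node h
      top       : Fin (suc k)
      inside    : ∀ i → r ⊑ addr (member i)
      below-top : ∀ i → member i ≡ member top ⊎ member i ≺ member top
      distinct  : Injective _≡_ _≡_ member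
      separated : ∀ {i j} → member i ≺ member j →
                  ∃ λ w → r ⊑ addr w × member top ≺ w × NodeEdge (member i) w × ¬ NodeEdge (member j) w

  needs-colours : ∀ {m} {c : Node h → Fin m} → Consistent NodeEdge _≺_ c → ∀ {k r} → Separated k r → suc k ≤ m
  needs-colours {c = c} consistent S = injective⇒≤ c∘member-injective
    where
    open Separated S
    before-top-before : ∀ j {w} → member top ≺ w → member j ≺ w
    before-top-before j t<w with below-top j
    ... | inj₁ j≡t = subst (_≺ _) (sym j≡t) t<w
    ... | inj₂ j<t = ≺-trans j<t t<w
    clash : ∀ {i j} → member i ≺ member j → c (member i) ≢ c (member j)
    clash {j = j} i<j ci≡cj with separated i<j
    ... | w , _ , t<w , iw , ¬jw = ¬jw (consistent _ _ w i<j (before-top-before j t<w) ci≡cj iw)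
    c∘member-injective : Injective _≡_ _≡_ (c ∘ member)
    c∘member-injective {i} {j} ci≡cj with compare (member i) (member j)
    ... | tri< i<j _ _ = ⊥-elim (clash i<j ci≡cj)
    ... | tri≈ _ i≡j _ = distinct i≡j
    ... | tri> _ _ j<i = ⊥-elim (clash j<i (sym ci≡cj))

  singleton : ∀ r → .(length r ≤ h) → Separated 0 r
  singleton r r≤h = record
    { member    = λ _ → node r r≤h
    ; top       = zero
    ; inside    = λ _ → ⊑-refl r
    ; below-top = λ _ → inj₁ refl
    ; distinct  = λ { {zero} {zero} _ → refl }
    ; separated = λ u<u → ⊥-elim (irrefl refl u<u)
    }

  extend : ∀ {k r p z} → p ⋖ z → r ⊑ z → (S : Separated k z) → let open Separated S in
           ∀ {u w} → NodeEdge u w → u ≺ member top → member top ≺ w →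
           r ⊑ addr u × Far p z (addr u) → r ⊑ addr w × Far p z (addr w) → Separated (suc k) r
  extend {k} {r} {p} {z} p⋖z r⊑z S {u} {w} uw u<t t<w (r⊑u , u-far) (r⊑w , w-far) = record
    { member    = member′
    ; top       = suc top
    ; inside    = inside′
    ; below-top = below-top′
    ; distinct  = distinct′
    ; separated = λ {i j} → separated′ {i} {j}
    }
    where
    open Separated S
    member′ : Fin (suc (suc k)) → Node h
    member′ zero    = u
    member′ (suc i) = member i
    inside′ : ∀ i → r ⊑ addr (member′ i)
    inside′ zero    = r⊑u
    inside′ (suc i) = ⊑-trans r⊑z (inside i)
    below-top′ : ∀ i → member′ i ≡ member top ⊎ member′ i ≺ member top
    below-top′ zero    = inj₂ u<t
    below-top′ (suc i) = below-top i
    u≢member : ∀ i → u ≢ member i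
    u≢member i refl = proj₁ u-far (inside i)
    distinct′ : Injective _≡_ _≡_ member′
    distinct′ {zero}  {zero}  _ = refl
    distinct′ {zero}  {suc j} e = ⊥-elim (u≢member j e)
    distinct′ {suc i} {zero}  e = ⊥-elim (u≢member i (sym e))
    distinct′ {suc i} {suc j} e = cong suc (distinct e)
    widen : ∀ {i j} → ∃ (λ v → z ⊑ addr v × member top ≺ v × NodeEdge (member i) v × ¬ NodeEdge (member j) v) →
           ∃ (λ v → r ⊑ addr v × member top ≺ v × NodeEdge (member i) v × ¬ NodeEdge (member j) v)
    widen (v , z⊑v , t<v , iv , ¬jv) = v , ⊑-trans r⊑z z⊑v , t<v , iv , ¬jv
    separated′ : ∀ {i j} → member′ i ≺ member′ j →
                 ∃ λ v → r ⊑ addr v × member top ≺ v × NodeEdge (member′ i) v × ¬ NodeEdge (member′ j) v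
    separated′ {zero}  {zero}  u<u = ⊥-elim (irrefl refl u<u)
    separated′ {zero}  {suc j} _   = w , r⊑w , t<w , uw , far⇒¬edge p⋖z (inside j) w-far
    separated′ {suc i} {zero}  i<u with below-top i
    ... | inj₁ i≡t = ⊥-elim (asym i<u (subst (u ≺_) (sym i≡t) u<t))
    ... | inj₂ i<t with separated i<t
    ...   | v , z⊑v , t<v , iv , _ = v , ⊑-trans r⊑z z⊑v , t<v , iv , far⇒¬edge p⋖z z⊑v u-far ∘ TreeEdge-sym
    separated′ {suc i} {suc j} i<j = widen (separated i<j)

  extend-across : ∀ {k r p z} → p ⋖ z → r ⊑ z → (S : Separated k z) → ∀ hub {x y} → r ⊑ hub → hub ⊑ addr x → hub ⊑ addr y →
                  (∀ {a} → hub ⊑ a → a ⊑ addr x ⊎ a ⊑ addr y → Far p z a) →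
                  Between ≺-sto x (Separated.member S (Separated.top S)) y → Separated (suc k) r
  extend-across {k} {r} {p} {z} p⋖z r⊑z S hub {node a qa} {node b qb} r⊑hub (β , a≡) (γ , b≡) far =
    extend-between
    where
    open Separated S
    Q : Addr → Set
    Q c = r ⊑ c × Far p z c
    avoids-top : ∀ {u v} → Q (addr u) × Q (addr v) × NodeEdge u v → v ≢ member top
    avoids-top (_ , (_ , (z⋢v , _)) , _) refl = z⋢v (inside top)
    extend-along : ∀ {s e} → Walk Q s e → s ≺ member top → member top ≺ e → Separated (suc k) r
    extend-along walk s<t t<e with crossing ≺-sto (λ {u v} → avoids-top {u} {v}) walk s<t t<e
    ... | u , w , (qu , qw , uw) , u<t , t<w = extend p⋖z r⊑z S uw u<t t<w qu qw
    hubNode : Node h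
    hubNode = node hub (≤-trans (⊑-length (β , a≡)) qa)
    to-x : Walk Q hubNode (node a qa)
    to-x = descent hub β a≡ λ c hub⊑c c⊑a → ⊑-trans r⊑hub hub⊑c , far hub⊑c (inj₁ c⊑a)
    to-y : Walk Q hubNode (node b qb)
    to-y = descent hub γ b≡ λ c hub⊑c c⊑b → ⊑-trans r⊑hub hub⊑c , far hub⊑c (inj₂ c⊑b)
    extend-between : Between ≺-sto (node a qa) (member top) (node b qb) → Separated (suc k) r
    extend-between (inj₁ (x<t , t<y)) = extend-along (walk-reverse to-x ◅◅ to-y) x<t t<y
    extend-between (inj₂ (y<t , t<x)) = extend-along (walk-reverse to-y ◅◅ to-x) y<t t<x

  separated-step : ∀ k r → length r + 3 * suc k ≤ h → (∀ z → length z + 3 * k ≤ h → Separated k z) →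
                   Separated (suc k) r
  separated-step k r room separated-below =
    extend-middle (middle-of-three ≺-sto
      (tops-distinct (inside (S left) _) branch⊑t (inner∥branch right) (⊑-refl _))
      (tops-distinct (inside S₃ _) branch⊑t (outer∥branch right) (⊑-refl _) ∘ sym)
      (tops-distinct (inside S₃ _) branch⊑t (outer∥branch left) (⊑-refl _) ∘ sym))
    where
    open Separated
    flip : Dir → Dir
    flip left  = right
    flip right = left
    branch inner : Dir → Addr
    branch d = r ++ left ∷ d ∷ []
    inner  d = r ++ left ∷ d ∷ left ∷ []
    outer : Addr
    outer = r ++ right ∷ []
    S : ∀ d → Separated k (inner d)
    S d = separated-below (inner d) (room-below r (left ∷ d ∷ left ∷ []) room ≤-refl)
    S₃ : Separated k outer
    S₃ = separated-below outer (room-below r (right ∷ []) room (s≤s z≤n))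
    t : Dir → Node h
    t d = member (S d) (top (S d))
    t₃ : Node h
    t₃ = member S₃ (top S₃)
    branch⊑t : ∀ {d} → branch d ⊑ addr (t d)
    branch⊑t {d} = ⊑-trans (left ∷ [] , sym (++-assoc r _ _)) (inside (S d) (top (S d)))
    tops-distinct : ∀ {z z′ u v x} → z ⊑ addr u → x ⊑ addr v → Incomparable z z′ → z′ ⊑ x → u ≢ v
    tops-distinct z⊑u x⊑v z∥z′ z′⊑x refl = incomparable-no-common-extension z∥z′ z⊑u (⊑-trans z′⊑x x⊑v)
    inner∥branch : ∀ d → Incomparable (inner (flip d)) (branch d)
    inner∥branch left  = incomparable-++ r ((λ { (_ , ()) }) , (λ { (_ , ()) }))
    inner∥branch right = incomparable-++ r ((λ { (_ , ()) }) , (λ { (_ , ()) }))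
    outer∥branch : ∀ d → Incomparable outer (branch d)
    outer∥branch d = incomparable-++ r ((λ { (_ , ()) }) , (λ { (_ , ()) }))
    extend-inner : ∀ d → Between ≺-sto (t (flip d)) (t d) t₃ → Separated (suc k) r
    extend-inner d = extend-across (left , sym (++-assoc r _ _)) (⊑-++ r _) (S d) r (⊑-refl r)
      (⊑-trans (⊑-++ r _) (inside (S (flip d)) _)) (⊑-trans (⊑-++ r _) (inside S₃ _)) far
      where
      far : ∀ {a} → r ⊑ a → a ⊑ addr (t (flip d)) ⊎ a ⊑ addr t₃ → Far (branch d) (inner d) a
      far _ (inj₁ a⊑) = far-from-branch (left , sym (++-assoc r _ _)) (inner∥branch d) (inside (S (flip d)) _) a⊑
      far _ (inj₂ a⊑) = far-from-branch (left , sym (++-assoc r _ _)) (outer∥branch d) (inside S₃ _) a⊑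
    extend-outer : Between ≺-sto (t left) t₃ (t right) → Separated (suc k) r
    extend-outer = extend-across (right , refl) (⊑-++ r _) S₃ hub (⊑-++ r _) (hub⊑ left) (hub⊑ right) far
      where
      hub : Addr
      hub = r ++ left ∷ []
      hub⊑ : ∀ d → hub ⊑ addr (t d)
      hub⊑ d = ⊑-trans (_ , sym (++-assoc r _ _)) (inside (S d) (top (S d)))
      hub⋢r : ¬ hub ⊑ r
      hub⋢r hub⊑r with ⊑-cancelˡ r (subst (hub ⊑_) (sym (++-identityʳ r)) hub⊑r)
      ... | _ , ()
      far : ∀ {a} → hub ⊑ a → a ⊑ addr (t left) ⊎ a ⊑ addr (t right) → Far r outer a
      far hub⊑a _ = far-below (incomparable-++ r ((λ { (_ , ()) }) , (λ { (_ , ()) }))) hub⋢r hub⊑a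
    extend-middle : Between ≺-sto (t right) (t left) t₃ ⊎ Between ≺-sto (t left) (t right) t₃ ⊎
                    Between ≺-sto (t left) t₃ (t right) → Separated (suc k) r
    extend-middle (inj₁ t-left-middle)         = extend-inner left t-left-middle
    extend-middle (inj₂ (inj₁ t-right-middle)) = extend-inner right t-right-middle
    extend-middle (inj₂ (inj₂ t₃-middle))      = extend-outer t₃-middle

  separated : ∀ k r → length r + 3 * k ≤ h → Separated k r
  separated zero    r room = singleton r (≤-trans (≤-reflexive (sym (+-identityʳ (length r)))) room)
  separated (suc k) r room = separated-step k r room (separated k)

  colours-needed : ∀ {m} {c : Node h → Fin m} → Consistent NodeEdge _≺_ c → ⌈ suc h /3⌉ ≤ m
  colours-needed {m} consistent =
    subst (_≤ m) (sym (⌈1+h/3⌉≡1+h/3 h)) (needs-colours consistent (separated (h / 3) [] room))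
    where
    room : 3 * (h / 3) ≤ h
    room = ≤-trans (≤-reflexive (*-comm 3 (h / 3))) (m/n*n≤m h 3)

isThin-nodeTree⇒≥ : ∀ {h k} → IsThin (NodeEdge {h}) k → ⌈ suc h /3⌉ ≤ k
isThin-nodeTree⇒≥ (_ , _ , ≺-sto , consistent) = LowerBound.colours-needed ≺-sto consistent

theorem20 : (h : ℕ) → Thinness (CBTEdge h) ⌈ suc h /3⌉
theorem20 h = isThin-fromNodeTree (isThin-nodeTree h) , λ k → isThin-nodeTree⇒≥ ∘ isThin-toNodeTree
  where open HeapNumbering h
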